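{- For every finite poset $P$ and every positive integer $m$, $$d(P)^m=\sum_{D\in\mathcal{D}(P)} e(m,P-D)=\sum_{U\in\mathcal{U}(P)} e(m,U),$$ and hence $$r(m,P):=d(P)^m-e(m,P)=\sum_{U\in\mathcal{U}(P)\setminus\{K\}} e(m,U),$$ where $K$ is the ground set of $P$.
   Context: For a finite poset $P$ on $K$, $\mathcal{D}(P)$ and $\mathcal{U}(P)$ are its sets of downsets and upsets, $d(P)=|\mathcal{D}(P)|$, $P-D$ is the subposet induced on $K\setminus D$, and $e(m,U)$ means $e(m,P|_U)$ for the induced subposet on $U$. For a finite poset $Q$ on a set $L$ and a finite set $M$ disjoint from $L$ with $|M|=m$, $e(m,Q)$ is the number of partial orders on $M\cup L$ inducing $Q$ on $L$ whose set of minimal elements is exactly $M$ (the empty poset has $e(m,\emptyset)=1$). -}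

module Defs where

open import Data.Bool using (Bool; true; false; _∧_; _∨_; not; if_then_else_)
open import Data.Nat using (ℕ; zero; suc; _+_; _^_; _∸_)
open import Data.Fin using (Fin; zero; suc; _↑ˡ_; _↑ʳ_; splitAt; _≟_)
open import Data.Sum using (inj₁; inj₂)
open import Data.List using (List; []; _∷_; [_]; map; concatMap; allFin; filterᵇ; length; lookup)
open import Data.Bool.ListAction using (all)
open import Relation.Nullary.Decidable using (⌊_⌋)

-- A (Boolean, hence decidable) binary relation on the finite set Fin n.
-- Convention: R x y = true means x ≤ y.
Rel : ℕ → Set
Rel n = Fin n → Fin n → Bool

Sub : ℕ → Set
Sub n = Fin n → Bool

∀ᶠ : (n : ℕ) → (Fin n → Bool) → Bool
∀ᶠ n p = all p (allFin n)

_⇒ᵇ_ : Bool → Bool → Bool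
a ⇒ᵇ b = not a ∨ b

isPartialOrder : {n : ℕ} → Rel n → Bool
isPartialOrder {n} R =
  ∀ᶠ n (λ x → R x x)
  ∧ ∀ᶠ n (λ x → ∀ᶠ n (λ y → (R x y ∧ R y x) ⇒ᵇ ⌊ x ≟ y ⌋))
  ∧ ∀ᶠ n (λ x → ∀ᶠ n (λ y → ∀ᶠ n (λ z → (R x y ∧ R y z) ⇒ᵇ R x z)))

cons : {A : Set} {n : ℕ} → A → (Fin n → A) → Fin (suc n) → A
cons a f zero = a
cons a f (suc i) = f i

allFuns : {A : Set} → (n : ℕ) → List A → List (Fin n → A)
allFuns zero xs = [ (λ ()) ]
allFuns (suc n) xs = concatMap (λ a → map (cons a) (allFuns n xs)) xs

allSubs : (n : ℕ) → List (Sub n)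
allSubs n = allFuns n (true ∷ false ∷ [])

allRels : (n : ℕ) → List (Rel n)
allRels n = allFuns n (allSubs n)

isDownset : {n : ℕ} → Rel n → Sub n → Bool
isDownset {n} P D = ∀ᶠ n (λ x → ∀ᶠ n (λ y → (P x y ∧ D y) ⇒ᵇ D x))

isUpset : {n : ℕ} → Rel n → Sub n → Bool
isUpset {n} P U = ∀ᶠ n (λ x → ∀ᶠ n (λ y → (P x y ∧ U x) ⇒ᵇ U y))

downsets : {n : ℕ} → Rel n → List (Sub n)
downsets {n} P = filterᵇ (isDownset P) (allSubs n)

upsets : {n : ℕ} → Rel n → List (Sub n)
upsets {n} P = filterᵇ (isUpset P) (allSubs n)

d : {n : ℕ} → Rel n → ℕ
d P = length (downsets P)

-- Induced subposet on a subset U, relabelled onto Fin |U| via the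
-- increasing enumeration of the elements of U.
elems : {n : ℕ} → Sub n → List (Fin n)
elems {n} U = filterᵇ U (allFin n)

induce : {n : ℕ} → Rel n → (U : Sub n) → Rel (length (elems U))
induce P U i j = P (lookup (elems U) i) (lookup (elems U) j)

complement : {n : ℕ} → Sub n → Sub n
complement U x = not (U x)

-- Ground set Fin (m + k): the first m elements form M, the last k form L.
inM : {m k : ℕ} → Fin (m + k) → Bool
inM {m} x with splitAt m x
... | inj₁ _ = true
... | inj₂ _ = false

isMinimal : {n : ℕ} → Rel n → Fin n → Bool
isMinimal {n} R x = ∀ᶠ n (λ y → R y x ⇒ᵇ ⌊ y ≟ x ⌋)

_⇔ᵇ_ : Bool → Bool → Bool
a ⇔ᵇ b = (a ⇒ᵇ b) ∧ (b ⇒ᵇ a)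

isExtension : (m : ℕ) {k : ℕ} → Rel k → Rel (m + k) → Bool
isExtension m {k} Q R =
  isPartialOrder R
  ∧ ∀ᶠ k (λ i → ∀ᶠ k (λ j → R (m ↑ʳ i) (m ↑ʳ j) ⇔ᵇ Q i j))
  ∧ ∀ᶠ (m + k) (λ x → isMinimal R x ⇔ᵇ inM {m} {k} x)

e : (m : ℕ) {k : ℕ} → Rel k → ℕ
e m {k} Q = length (filterᵇ (isExtension m Q) (allRels (m + k)))

eSub : (m : ℕ) {n : ℕ} → Rel n → Sub n → ℕ
eSub m P U = e m (induce P U)

isFull : {n : ℕ} → Sub n → Bool
isFull {n} U = ∀ᶠ n U

r : (m : ℕ) {n : ℕ} → Rel n → ℕ
r m P = d P ^ m ∸ e m P

-- If R is a partial order on M ∪ U extending P|U whose minimal elements are exactly M, then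
-- for each a ∈ M the set of elements of U above a is an upset of P, and these m upsets cover U
-- because every element lies above a minimal one; conversely every m-tuple of upsets of P with
-- union U defines such an extension. Summing e(m, U) over all upsets U therefore counts all
-- m-tuples of upsets of P, and there are d(P)^m of them since complementation matches downsets
-- with upsets. The summand for U = K is e(m, P), which gives the formula for r(m, P).

module Submission where

open import Defs
open import Algebra.Properties.CommutativeSemigroup using (interchange)
open import Data.Bool using (Bool; true; false; _∧_; _∨_; not; if_then_else_)
open import Data.Bool.Properties using (¬-not; not-involutive; T-≡; T?)
open import Data.Bool.ListAction using (all)
open import Data.Empty using (⊥; ⊥-elim)
open import Data.Fin using (Fin; zero; suc; _≟_; _↑ˡ_; _↑ʳ_; splitAt; join)
open import Data.Fin.Properties using (splitAt-↑ˡ; splitAt-↑ʳ; join-splitAt; ↑ˡ-injective)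
open import Data.List using (List; []; _∷_; map; concatMap; allFin; filterᵇ; length; lookup; tabulate; _++_)
open import Data.List.Membership.Propositional using (_∈_)
open import Data.List.Membership.Propositional.Properties using (∈-allFin; ∈-lookup; ∈-filter⁺; ∈-filter⁻)
import Data.List.Relation.Unary.All as All
open import Data.List.Relation.Unary.AllPairs using (_∷_)
open import Data.List.Relation.Unary.Any using (here; there; index)
open import Data.List.Relation.Unary.Any.Properties using (lookup-index)
open import Data.List.Relation.Unary.Unique.Propositional using (Unique)
open import Data.List.Relation.Unary.Unique.Propositional.Properties using (allFin⁺; filter⁺)
open import Data.Nat using (ℕ; zero; suc; _+_; _*_; _^_; _∸_; _≤_; _<_; z≤n; s≤s; s≤s⁻¹)
open import Data.Nat.ListAction using (sum)
open import Data.Nat.Properties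
  using (+-assoc; +-commutativeSemigroup; +-identityʳ; *-distribʳ-+; +-mono-≤; +-mono-<-≤; +-mono-≤-<; ≤-refl; ≤-trans; m+n∸n≡m)
open import Data.Product using (∃; _,_; proj₁; proj₂; _×_)
open import Data.Sum using (_⊎_; inj₁; inj₂)
open import Function using (_∘_; id)
open import Function.Bundles using (Equivalence)
open import Relation.Nullary.Decidable using (⌊_⌋; yes; no)
open import Relation.Binary.PropositionalEquality
  using (_≡_; _≢_; refl; sym; trans; cong; cong₂; subst; subst₂; module ≡-Reasoning)

true≢false : true ≢ false
true≢false ()

≢true⇒≡false : {a : Bool} → a ≢ true → a ≡ false
≢true⇒≡false = ¬-not

≡-from-⇔-true : {a b : Bool} → (a ≡ true → b ≡ true) → (b ≡ true → a ≡ true) → a ≡ b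
≡-from-⇔-true {true} {true} _ _ = refl
≡-from-⇔-true {true} {false} f _ = sym (f refl)
≡-from-⇔-true {false} {true} _ g = g refl
≡-from-⇔-true {false} {false} _ _ = refl

∧-true⁻ˡ : {a b : Bool} → a ∧ b ≡ true → a ≡ true
∧-true⁻ˡ {true} _ = refl

∧-true⁻ʳ : {a b : Bool} → a ∧ b ≡ true → b ≡ true
∧-true⁻ʳ {true} h = h

∧-true⁺ : {a b : Bool} → a ≡ true → b ≡ true → a ∧ b ≡ true
∧-true⁺ refl refl = refl

⇒ᵇ-true⁻ : {a b : Bool} → (a ⇒ᵇ b) ≡ true → a ≡ true → b ≡ true
⇒ᵇ-true⁻ {true} h refl = h

⇒ᵇ-true⁺ : {a b : Bool} → (a ≡ true → b ≡ true) → (a ⇒ᵇ b) ≡ true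
⇒ᵇ-true⁺ {true} f = f refl
⇒ᵇ-true⁺ {false} _ = refl

⇒ᵇ-false⁻ : {a b : Bool} → (a ⇒ᵇ b) ≡ false → a ≡ true × b ≡ false
⇒ᵇ-false⁻ {true} {false} _ = refl , refl

⇔ᵇ-true⁺ : {a b : Bool} → a ≡ b → (a ⇔ᵇ b) ≡ true
⇔ᵇ-true⁺ {true} refl = refl
⇔ᵇ-true⁺ {false} refl = refl

⇔ᵇ-true⁻ : {a b : Bool} → (a ⇔ᵇ b) ≡ true → a ≡ b
⇔ᵇ-true⁻ {a} h = ≡-from-⇔-true (⇒ᵇ-true⁻ (∧-true⁻ˡ h)) (⇒ᵇ-true⁻ (∧-true⁻ʳ {a ⇒ᵇ _} h))

∧⇒ᵇ-cong : {a a' b b' c c' : Bool} → a ≡ a' → b ≡ b' → c ≡ c' → ((a ∧ b) ⇒ᵇ c) ≡ ((a' ∧ b') ⇒ᵇ c')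
∧⇒ᵇ-cong refl refl refl = refl

∧⇒ᵇ-contraposition : (a b c : Bool) → ((a ∧ not b) ⇒ᵇ not c) ≡ ((a ∧ c) ⇒ᵇ b)
∧⇒ᵇ-contraposition true true true = refl
∧⇒ᵇ-contraposition true true false = refl
∧⇒ᵇ-contraposition true false true = refl
∧⇒ᵇ-contraposition true false false = refl
∧⇒ᵇ-contraposition false b c = refl

≟-sound : {n : ℕ} {x y : Fin n} → ⌊ x ≟ y ⌋ ≡ true → x ≡ y
≟-sound {x = x} {y} h with x ≟ y
... | yes x≡y = x≡y

≟-complete : {n : ℕ} {x y : Fin n} → x ≡ y → ⌊ x ≟ y ⌋ ≡ true
≟-complete {x = x} refl with x ≟ x
... | yes _ = refl
... | no x≢x = ⊥-elim (x≢x refl)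

all-tabulate⁻ : {A : Set} {n : ℕ} (p : A → Bool) (f : Fin n → A) →
  all p (tabulate f) ≡ true → ∀ i → p (f i) ≡ true
all-tabulate⁻ p f h zero = ∧-true⁻ˡ h
all-tabulate⁻ p f h (suc i) = all-tabulate⁻ p (f ∘ suc) (∧-true⁻ʳ {p (f zero)} h) i

all-tabulate⁺ : {A : Set} {n : ℕ} (p : A → Bool) (f : Fin n → A) →
  (∀ i → p (f i) ≡ true) → all p (tabulate f) ≡ true
all-tabulate⁺ {n = zero} p f h = refl
all-tabulate⁺ {n = suc n} p f h = ∧-true⁺ (h zero) (all-tabulate⁺ p (f ∘ suc) (h ∘ suc))

all-tabulate-false⁻ : {A : Set} {n : ℕ} (p : A → Bool) (f : Fin n → A) →
  all p (tabulate f) ≡ false → ∃ λ i → p (f i) ≡ false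
all-tabulate-false⁻ {n = suc n} p f h with p (f zero) in eq
... | true = let (i , q) = all-tabulate-false⁻ p (f ∘ suc) h in suc i , q
... | false = zero , eq

∀ᶠ-true⁻ : {n : ℕ} {p : Fin n → Bool} → ∀ᶠ n p ≡ true → ∀ i → p i ≡ true
∀ᶠ-true⁻ {p = p} = all-tabulate⁻ p id

∀ᶠ-true⁺ : {n : ℕ} {p : Fin n → Bool} → (∀ i → p i ≡ true) → ∀ᶠ n p ≡ true
∀ᶠ-true⁺ {p = p} = all-tabulate⁺ p id

∀ᶠ-false⁻ : {n : ℕ} {p : Fin n → Bool} → ∀ᶠ n p ≡ false → ∃ λ i → p i ≡ false
∀ᶠ-false⁻ {p = p} = all-tabulate-false⁻ p id

∀ᶠ-cong : {n : ℕ} {p q : Fin n → Bool} → (∀ i → p i ≡ q i) → ∀ᶠ n p ≡ ∀ᶠ n q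
∀ᶠ-cong h = ≡-from-⇔-true (λ a → ∀ᶠ-true⁺ λ i → trans (sym (h i)) (∀ᶠ-true⁻ a i))
                          (λ a → ∀ᶠ-true⁺ λ i → trans (h i) (∀ᶠ-true⁻ a i))

-- Structurally recursive quantifiers, so that a statement about Fin (suc n) unfolds to one about Fin n.
allᶠ : (n : ℕ) → (Fin n → Bool) → Bool
allᶠ zero p = true
allᶠ (suc n) p = p zero ∧ allᶠ n (p ∘ suc)

anyᶠ : (n : ℕ) → (Fin n → Bool) → Bool
anyᶠ zero p = false
anyᶠ (suc n) p = p zero ∨ anyᶠ n (p ∘ suc)

allᶠ-true⁻ : {n : ℕ} {p : Fin n → Bool} → allᶠ n p ≡ true → ∀ i → p i ≡ true
allᶠ-true⁻ h zero = ∧-true⁻ˡ h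
allᶠ-true⁻ {suc n} {p} h (suc i) = allᶠ-true⁻ {n} (∧-true⁻ʳ {p zero} h) i

allᶠ-true⁺ : {n : ℕ} {p : Fin n → Bool} → (∀ i → p i ≡ true) → allᶠ n p ≡ true
allᶠ-true⁺ {zero} h = refl
allᶠ-true⁺ {suc n} h = ∧-true⁺ (h zero) (allᶠ-true⁺ (h ∘ suc))

anyᶠ-true⁺ : {n : ℕ} {p : Fin n → Bool} (i : Fin n) → p i ≡ true → anyᶠ n p ≡ true
anyᶠ-true⁺ zero h rewrite h = refl
anyᶠ-true⁺ {suc n} {p} (suc i) h with p zero
... | true = refl
... | false = anyᶠ-true⁺ i h

anyᶠ-true⁻ : {n : ℕ} {p : Fin n → Bool} → anyᶠ n p ≡ true → ∃ λ i → p i ≡ true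
anyᶠ-true⁻ {suc n} {p} h with p zero in eq
... | true = zero , eq
... | false = let (i , q) = anyᶠ-true⁻ {n} h in suc i , q

anyᶠ-cong : {n : ℕ} {p q : Fin n → Bool} → (∀ i → p i ≡ q i) → anyᶠ n p ≡ anyᶠ n q
anyᶠ-cong h = ≡-from-⇔-true (λ a → let (i , r) = anyᶠ-true⁻ a in anyᶠ-true⁺ i (trans (sym (h i)) r))
                            (λ a → let (i , r) = anyᶠ-true⁻ a in anyᶠ-true⁺ i (trans (h i) r))

∑ : {A : Set} → List A → (A → ℕ) → ℕ
∑ [] f = 0
∑ (x ∷ xs) f = f x + ∑ xs f

_⊙_ : Bool → ℕ → ℕ
b ⊙ n = if b then n else 0
infixr 7 _⊙_

sum-map : {A : Set} (xs : List A) (f : A → ℕ) → sum (map f xs) ≡ ∑ xs f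
sum-map [] f = refl
sum-map (x ∷ xs) f = cong (f x +_) (sum-map xs f)

∑-cong : {A : Set} (xs : List A) {f g : A → ℕ} → (∀ x → f x ≡ g x) → ∑ xs f ≡ ∑ xs g
∑-cong [] h = refl
∑-cong (x ∷ xs) h = cong₂ _+_ (h x) (∑-cong xs h)

∑-++ : {A : Set} (xs ys : List A) (f : A → ℕ) → ∑ (xs ++ ys) f ≡ ∑ xs f + ∑ ys f
∑-++ [] ys f = refl
∑-++ (x ∷ xs) ys f = trans (cong (f x +_) (∑-++ xs ys f)) (sym (+-assoc (f x) _ _))

∑-map : {A B : Set} (xs : List A) (h : A → B) (f : B → ℕ) → ∑ (map h xs) f ≡ ∑ xs (f ∘ h)
∑-map [] h f = refl
∑-map (x ∷ xs) h f = cong (f (h x) +_) (∑-map xs h f)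

∑-concatMap : {A B : Set} (xs : List A) (g : A → List B) (f : B → ℕ) →
  ∑ (concatMap g xs) f ≡ ∑ xs (λ a → ∑ (g a) f)
∑-concatMap [] g f = refl
∑-concatMap (x ∷ xs) g f = trans (∑-++ (g x) (concatMap g xs) f) (cong (∑ (g x) f +_) (∑-concatMap xs g f))

∑-zero : {A : Set} (xs : List A) → ∑ xs (λ _ → 0) ≡ 0
∑-zero [] = refl
∑-zero (x ∷ xs) = ∑-zero xs

∑-+ : {A : Set} (xs : List A) (f g : A → ℕ) → ∑ xs (λ x → f x + g x) ≡ ∑ xs f + ∑ xs g
∑-+ [] f g = refl
∑-+ (x ∷ xs) f g = trans (cong (f x + g x +_) (∑-+ xs f g))
                         (interchange +-commutativeSemigroup (f x) (g x) (∑ xs f) (∑ xs g))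

∑-*ʳ : {A : Set} (xs : List A) (c : ℕ) (f : A → ℕ) → ∑ xs (λ x → f x * c) ≡ ∑ xs f * c
∑-*ʳ [] c f = refl
∑-*ʳ (x ∷ xs) c f = trans (cong (f x * c +_) (∑-*ʳ xs c f)) (sym (*-distribʳ-+ c (f x) _))

∑-⊙ : {A : Set} (xs : List A) (b : Bool) (f : A → ℕ) → ∑ xs (λ x → b ⊙ f x) ≡ b ⊙ ∑ xs f
∑-⊙ xs true f = refl
∑-⊙ xs false f = ∑-zero xs

∑-swap : {A B : Set} (xs : List A) (ys : List B) (h : A → B → ℕ) →
  ∑ xs (λ x → ∑ ys (h x)) ≡ ∑ ys (λ y → ∑ xs (λ x → h x y))
∑-swap [] ys h = sym (∑-zero ys)
∑-swap (x ∷ xs) ys h = trans (cong (∑ ys (h x) +_) (∑-swap xs ys h))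
                             (sym (∑-+ ys (h x) (λ y → ∑ xs (λ x′ → h x′ y))))

⊙-∧ : (a b : Bool) (n : ℕ) → (a ∧ b) ⊙ n ≡ a ⊙ b ⊙ n
⊙-∧ true b n = refl
⊙-∧ false b n = refl

⊙1-* : (b : Bool) (n : ℕ) → b ⊙ n ≡ (b ⊙ 1) * n
⊙1-* true n = sym (+-identityʳ n)
⊙1-* false n = refl

⊙-cong-true : (b : Bool) {x y : ℕ} → (b ≡ true → x ≡ y) → b ⊙ x ≡ b ⊙ y
⊙-cong-true true h = h refl
⊙-cong-true false h = refl

∑-filterᵇ : {A : Set} (p : A → Bool) (f : A → ℕ) (xs : List A) → ∑ (filterᵇ p xs) f ≡ ∑ xs (λ x → p x ⊙ f x)
∑-filterᵇ p f [] = refl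
∑-filterᵇ p f (x ∷ xs) with p x
... | true = cong (f x +_) (∑-filterᵇ p f xs)
... | false = ∑-filterᵇ p f xs

length-filterᵇ : {A : Set} (p : A → Bool) (xs : List A) → length (filterᵇ p xs) ≡ ∑ xs (λ x → p x ⊙ 1)
length-filterᵇ p [] = refl
length-filterᵇ p (x ∷ xs) with p x
... | true = cong suc (length-filterᵇ p xs)
... | false = length-filterᵇ p xs

∑-mono-≤ : {A : Set} (xs : List A) {f g : A → ℕ} → (∀ x → f x ≤ g x) → ∑ xs f ≤ ∑ xs g
∑-mono-≤ [] h = z≤n
∑-mono-≤ (x ∷ xs) h = +-mono-≤ (h x) (∑-mono-≤ xs h)

∑-mono-< : {A : Set} (xs : List A) {f g : A → ℕ} → (∀ x → f x ≤ g x) →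
  {x : A} → x ∈ xs → f x < g x → ∑ xs f < ∑ xs g
∑-mono-< (y ∷ xs) h (here refl) lt = +-mono-<-≤ lt (∑-mono-≤ xs h)
∑-mono-< (y ∷ xs) h (there x∈xs) lt = +-mono-≤-< (h y) (∑-mono-< xs h x∈xs lt)

-- Functions can only be compared pointwise, so a type is enumerated up to a Boolean
-- equivalence: every element is equivalent to exactly one listed element.
record Enumeration (A : Set) : Set where
  field
    elements : List A
    _≈ᵇ_ : A → A → Bool
    counted-once : ∀ a → ∑ elements (λ x → (a ≈ᵇ x) ⊙ 1) ≡ 1

module _ {A : Set} (E : Enumeration A) where
  open Enumeration E

  ∑-collapse : ∀ a (w : A → ℕ) → (∀ x → a ≈ᵇ x ≡ true → w x ≡ w a) →
    ∑ elements (λ x → (a ≈ᵇ x) ⊙ w x) ≡ w a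
  ∑-collapse a w w-resp = begin
      ∑ elements (λ x → (a ≈ᵇ x) ⊙ w x)
    ≡⟨ ∑-cong elements pointwise ⟩
      ∑ elements (λ x → ((a ≈ᵇ x) ⊙ 1) * w a)
    ≡⟨ ∑-*ʳ elements (w a) (λ x → (a ≈ᵇ x) ⊙ 1) ⟩
      ∑ elements (λ x → (a ≈ᵇ x) ⊙ 1) * w a
    ≡⟨ cong (_* w a) (counted-once a) ⟩
      1 * w a
    ≡⟨ +-identityʳ (w a) ⟩
      w a ∎
    where
    open ≡-Reasoning
    pointwise : ∀ x → (a ≈ᵇ x) ⊙ w x ≡ ((a ≈ᵇ x) ⊙ 1) * w a
    pointwise x with a ≈ᵇ x in a≈x
    ... | true = trans (w-resp x a≈x) (sym (+-identityʳ (w a)))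
    ... | false = refl

_≡ᵇ_ : Bool → Bool → Bool
true ≡ᵇ b = b
false ≡ᵇ b = not b

≡ᵇ-sound : {a b : Bool} → a ≡ᵇ b ≡ true → a ≡ b
≡ᵇ-sound {true} refl = refl
≡ᵇ-sound {false} {false} refl = refl

≡ᵇ-complete : {a b : Bool} → a ≡ b → a ≡ᵇ b ≡ true
≡ᵇ-complete {true} refl = refl
≡ᵇ-complete {false} refl = refl

boolEnumeration : Enumeration Bool
boolEnumeration = record
  { elements = true ∷ false ∷ []
  ; _≈ᵇ_ = _≡ᵇ_
  ; counted-once = λ { true → refl ; false → refl } }

functionEnumeration : {A : Set} (n : ℕ) → Enumeration A → Enumeration (Fin n → A)
functionEnumeration {A} n E = record
  { elements = allFuns n elements
  ; _≈ᵇ_ = λ f g → allᶠ n (λ i → f i ≈ᵇ g i)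
  ; counted-once = counted-once′ n }
  where
  open Enumeration E
  counted-once′ : (n : ℕ) (g : Fin n → A) →
    ∑ (allFuns n elements) (λ f → allᶠ n (λ i → g i ≈ᵇ f i) ⊙ 1) ≡ 1
  counted-once′ zero g = refl
  counted-once′ (suc n) g = begin
      ∑ (concatMap (λ a → map (cons a) (allFuns n elements)) elements) [g≈_]
    ≡⟨ ∑-concatMap elements _ [g≈_] ⟩
      ∑ elements (λ a → ∑ (map (cons a) (allFuns n elements)) [g≈_])
    ≡⟨ ∑-cong elements (λ a → trans (∑-map (allFuns n elements) (cons a) [g≈_]) (head-then-tail a)) ⟩
      ∑ elements (λ a → (g zero ≈ᵇ a) ⊙ 1)
    ≡⟨ counted-once (g zero) ⟩
      1 ∎
    where
    open ≡-Reasoning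
    [g≈_] : (Fin (suc n) → A) → ℕ
    [g≈ f ] = allᶠ (suc n) (λ i → g i ≈ᵇ f i) ⊙ 1
    head-then-tail : ∀ a → ∑ (allFuns n elements) ([g≈_] ∘ cons a) ≡ (g zero ≈ᵇ a) ⊙ 1
    head-then-tail a = begin
        ∑ (allFuns n elements) ([g≈_] ∘ cons a)
      ≡⟨ ∑-cong (allFuns n elements) (λ f → ⊙-∧ (g zero ≈ᵇ a) _ 1) ⟩
        ∑ (allFuns n elements) (λ f → (g zero ≈ᵇ a) ⊙ allᶠ n (λ i → g (suc i) ≈ᵇ f i) ⊙ 1)
      ≡⟨ ∑-⊙ (allFuns n elements) (g zero ≈ᵇ a) _ ⟩
        (g zero ≈ᵇ a) ⊙ ∑ (allFuns n elements) (λ f → allᶠ n (λ i → g (suc i) ≈ᵇ f i) ⊙ 1)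
      ≡⟨ cong ((g zero ≈ᵇ a) ⊙_) (counted-once′ n (g ∘ suc)) ⟩
        (g zero ≈ᵇ a) ⊙ 1 ∎

-- Opaque so that unification sees U ≈ˢ V rather than a stuck unfolding of it.
opaque
  _≈ˢ_ : {n : ℕ} → Sub n → Sub n → Bool
  _≈ˢ_ {n} U V = allᶠ n (λ y → U y ≡ᵇ V y)

  ≈ˢ-sound : {n : ℕ} {U V : Sub n} → U ≈ˢ V ≡ true → ∀ y → U y ≡ V y
  ≈ˢ-sound {n} h y = ≡ᵇ-sound (allᶠ-true⁻ {n} h y)

  ≈ˢ-complete : {n : ℕ} {U V : Sub n} → (∀ y → U y ≡ V y) → U ≈ˢ V ≡ true
  ≈ˢ-complete {n} h = allᶠ-true⁺ {n} (≡ᵇ-complete ∘ h)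

  ≈ˢ-counted-once : {n : ℕ} (U : Sub n) → ∑ (allSubs n) (λ V → (U ≈ˢ V) ⊙ 1) ≡ 1
  ≈ˢ-counted-once {n} = Enumeration.counted-once (functionEnumeration n boolEnumeration)

subsetEnumeration : (n : ℕ) → Enumeration (Sub n)
subsetEnumeration n = record { elements = allSubs n ; _≈ᵇ_ = _≈ˢ_ ; counted-once = ≈ˢ-counted-once }

≈ˢ-respʳ : {n : ℕ} (U : Sub n) {V W : Sub n} → V ≈ˢ W ≡ true → U ≈ˢ V ≡ U ≈ˢ W
≈ˢ-respʳ U {V} {W} V≈W = ≡-from-⇔-true
  (λ U≈V → ≈ˢ-complete λ y → trans (≈ˢ-sound U≈V y) (≈ˢ-sound V≈W y))
  (λ U≈W → ≈ˢ-complete λ y → trans (≈ˢ-sound U≈W y) (sym (≈ˢ-sound V≈W y)))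

count-allFuns : {A : Set} (m : ℕ) (xs : List A) (p : A → Bool) →
  ∑ (allFuns m xs) (λ T → allᶠ m (λ a → p (T a)) ⊙ 1) ≡ ∑ xs (λ x → p x ⊙ 1) ^ m
count-allFuns zero xs p = refl
count-allFuns {A} (suc m) xs p = begin
    ∑ (concatMap (λ a → map (cons a) (allFuns m xs)) xs) count
  ≡⟨ ∑-concatMap xs _ count ⟩
    ∑ xs (λ a → ∑ (map (cons a) (allFuns m xs)) count)
  ≡⟨ ∑-cong xs (λ a → trans (∑-map (allFuns m xs) (cons a) count) (head-then-tail a)) ⟩
    ∑ xs (λ x → (p x ⊙ 1) * ∑ xs (λ x → p x ⊙ 1) ^ m)
  ≡⟨ ∑-*ʳ xs _ (λ x → p x ⊙ 1) ⟩
    ∑ xs (λ x → p x ⊙ 1) ^ suc m ∎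
  where
  open ≡-Reasoning
  count : (Fin (suc m) → A) → ℕ
  count T = allᶠ (suc m) (λ a → p (T a)) ⊙ 1
  head-then-tail : ∀ a → ∑ (allFuns m xs) (count ∘ cons a) ≡ (p a ⊙ 1) * ∑ xs (λ x → p x ⊙ 1) ^ m
  head-then-tail a = begin
      ∑ (allFuns m xs) (count ∘ cons a)
    ≡⟨ ∑-cong (allFuns m xs) (λ T → ⊙-∧ (p a) _ 1) ⟩
      ∑ (allFuns m xs) (λ T → p a ⊙ allᶠ m (λ b → p (T b)) ⊙ 1)
    ≡⟨ ∑-⊙ (allFuns m xs) (p a) _ ⟩
      p a ⊙ ∑ (allFuns m xs) (λ T → allᶠ m (λ b → p (T b)) ⊙ 1)
    ≡⟨ cong (p a ⊙_) (count-allFuns m xs p) ⟩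
      p a ⊙ ∑ xs (λ x → p x ⊙ 1) ^ m
    ≡⟨ ⊙1-* (p a) _ ⟩
      (p a ⊙ 1) * ∑ xs (λ x → p x ⊙ 1) ^ m ∎

-- Double counting of the pairs (x , y) with p x and φ x ≈ y, which are exactly
-- the pairs with q y and ψ y ≈ x.
∑-reindex : {A B : Set} (EA : Enumeration A) (EB : Enumeration B)
  (p : A → Bool) (q : B → Bool) (w₁ : A → ℕ) (w₂ : B → ℕ) (φ : A → B) (ψ : B → A) →
  let open Enumeration EA using () renaming (_≈ᵇ_ to _≈ᴬ_)
      open Enumeration EB using () renaming (_≈ᵇ_ to _≈ᴮ_) in
  (∀ x y → p x ≡ true → φ x ≈ᴮ y ≡ true → (q y ≡ true × ψ y ≈ᴬ x ≡ true) × w₂ y ≡ w₁ x) →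
  (∀ x y → q y ≡ true → ψ y ≈ᴬ x ≡ true → p x ≡ true × φ x ≈ᴮ y ≡ true) →
  ∑ (Enumeration.elements EA) (λ x → p x ⊙ w₁ x) ≡ ∑ (Enumeration.elements EB) (λ y → q y ⊙ w₂ y)
∑-reindex EA EB p q w₁ w₂ φ ψ forth back = begin
    ∑ LA (λ x → p x ⊙ w₁ x)
  ≡⟨ ∑-cong LA (λ x → cong (p x ⊙_) (sym (∑-collapse EB (φ x) (λ _ → w₁ x) (λ _ _ → refl)))) ⟩
    ∑ LA (λ x → p x ⊙ ∑ LB (λ y → (φ x ≈ᴮ y) ⊙ w₁ x))
  ≡⟨ ∑-cong LA (λ x → sym (∑-⊙ LB (p x) _)) ⟩
    ∑ LA (λ x → ∑ LB (λ y → p x ⊙ (φ x ≈ᴮ y) ⊙ w₁ x))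
  ≡⟨ ∑-swap LA LB _ ⟩
    ∑ LB (λ y → ∑ LA (λ x → p x ⊙ (φ x ≈ᴮ y) ⊙ w₁ x))
  ≡⟨ ∑-cong LB (λ y → ∑-cong LA (λ x → pair x y)) ⟩
    ∑ LB (λ y → ∑ LA (λ x → q y ⊙ (ψ y ≈ᴬ x) ⊙ w₂ y))
  ≡⟨ ∑-cong LB (λ y → ∑-⊙ LA (q y) _) ⟩
    ∑ LB (λ y → q y ⊙ ∑ LA (λ x → (ψ y ≈ᴬ x) ⊙ w₂ y))
  ≡⟨ ∑-cong LB (λ y → cong (q y ⊙_) (∑-collapse EA (ψ y) (λ _ → w₂ y) (λ _ _ → refl))) ⟩
    ∑ LB (λ y → q y ⊙ w₂ y) ∎
  where
  open ≡-Reasoning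
  open Enumeration EA renaming (elements to LA; _≈ᵇ_ to _≈ᴬ_)
  open Enumeration EB renaming (elements to LB; _≈ᵇ_ to _≈ᴮ_)

  no-back : ∀ x y (b c : Bool) → q y ≡ b → ψ y ≈ᴬ x ≡ c →
    (p x ≡ true → φ x ≈ᴮ y ≡ true → ⊥) → b ⊙ c ⊙ w₂ y ≡ 0
  no-back x y true true qy ψy≈x not-forth = ⊥-elim (let (px , φx≈y) = back x y qy ψy≈x in not-forth px φx≈y)
  no-back x y true false _ _ _ = refl
  no-back x y false c _ _ _ = refl

  pair : ∀ x y → p x ⊙ (φ x ≈ᴮ y) ⊙ w₁ x ≡ q y ⊙ (ψ y ≈ᴬ x) ⊙ w₂ y
  pair x y with p x in px | φ x ≈ᴮ y in φx≈y
  ... | true | true with forth x y px φx≈y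
  ...   | (qy , ψy≈x) , w≡ rewrite qy | ψy≈x = sym w≡
  pair x y | true | false =
    sym (no-back x y _ _ refl refl (λ _ φx≈y′ → true≢false (trans (sym φx≈y′) φx≈y)))
  pair x y | false | _ =
    sym (no-back x y _ _ refl refl (λ px′ _ → true≢false (trans (sym px′) px)))

module PartialOrder {N : ℕ} (R : Rel N) (isPO : isPartialOrder R ≡ true) where
  po-refl : ∀ x → R x x ≡ true
  po-refl = ∀ᶠ-true⁻ (∧-true⁻ˡ isPO)

  po-antisym : ∀ {x y} → R x y ≡ true → R y x ≡ true → x ≡ y
  po-antisym {x} {y} r s =
    ≟-sound (⇒ᵇ-true⁻ (∀ᶠ-true⁻ (∀ᶠ-true⁻ (∧-true⁻ˡ (∧-true⁻ʳ {∀ᶠ N (λ x → R x x)} isPO)) x) y) (∧-true⁺ r s))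

  po-trans : ∀ {x y z} → R x y ≡ true → R y z ≡ true → R x z ≡ true
  po-trans {x} {y} {z} r s =
    ⇒ᵇ-true⁻ (∀ᶠ-true⁻ (∀ᶠ-true⁻ (∀ᶠ-true⁻ transitive x) y) z) (∧-true⁺ r s)
    where
    transitive : ∀ᶠ N (λ x → ∀ᶠ N (λ y → ∀ᶠ N (λ z → (R x y ∧ R y z) ⇒ᵇ R x z))) ≡ true
    transitive = ∧-true⁻ʳ {∀ᶠ N (λ x → ∀ᶠ N (λ y → (R x y ∧ R y x) ⇒ᵇ ⌊ x ≟ y ⌋))}
                          (∧-true⁻ʳ {∀ᶠ N (λ x → R x x)} isPO)

  #below : Fin N → ℕ
  #below x = ∑ (allFin N) (λ y → R y x ⊙ 1)

  -- Descend while x is not minimal; #below strictly decreases along the way.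
  minimal-below′ : (fuel : ℕ) → ∀ x → #below x < fuel → ∃ λ z → isMinimal R z ≡ true × R z x ≡ true
  minimal-below′ (suc fuel) x #x<fuel with isMinimal R x in x-minimal
  ... | true = x , x-minimal , po-refl x
  ... | false =
    let (z , z-minimal , z≤y) = minimal-below′ fuel y #y<fuel in z , z-minimal , po-trans z≤y y≤x
    where
    counterexample : ∃ λ y → (R y x ⇒ᵇ ⌊ y ≟ x ⌋) ≡ false
    counterexample = ∀ᶠ-false⁻ x-minimal
    y : Fin N
    y = proj₁ counterexample
    y≤x : R y x ≡ true
    y≤x = proj₁ (⇒ᵇ-false⁻ (proj₂ counterexample))
    y≢x : ⌊ y ≟ x ⌋ ≡ false
    y≢x = proj₂ (⇒ᵇ-false⁻ (proj₂ counterexample))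
    x≰y : R x y ≡ false
    x≰y = ≢true⇒≡false (λ x≤y → true≢false (trans (sym (≟-complete (po-antisym y≤x x≤y))) y≢x))
    below-y⊆below-x : ∀ w → R w y ⊙ 1 ≤ R w x ⊙ 1
    below-y⊆below-x w with R w y in w≤y
    ... | true rewrite po-trans w≤y y≤x = ≤-refl
    ... | false = z≤n
    x-only-below-x : R x y ⊙ 1 < R x x ⊙ 1
    x-only-below-x rewrite x≰y | po-refl x = s≤s z≤n
    #y<fuel : #below y < fuel
    #y<fuel = ≤-trans (∑-mono-< (allFin N) below-y⊆below-x (∈-allFin x) x-only-below-x) (s≤s⁻¹ #x<fuel)

  minimal-below : ∀ x → ∃ λ z → isMinimal R z ≡ true × R z x ≡ true
  minimal-below x = minimal-below′ (suc (#below x)) x ≤-refl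

module _ {n : ℕ} (P : Rel n) where
  isUpset⁻ : {U : Sub n} → isUpset P U ≡ true → ∀ {x y} → P x y ≡ true → U x ≡ true → U y ≡ true
  isUpset⁻ h {x} {y} x≤y x∈U = ⇒ᵇ-true⁻ (∀ᶠ-true⁻ (∀ᶠ-true⁻ h x) y) (∧-true⁺ x≤y x∈U)

  isUpset⁺ : {U : Sub n} → (∀ {x y} → P x y ≡ true → U x ≡ true → U y ≡ true) → isUpset P U ≡ true
  isUpset⁺ {U} h = ∀ᶠ-true⁺ λ x → ∀ᶠ-true⁺ λ y → ⇒ᵇ-true⁺ {P x y ∧ U x} λ r → h (∧-true⁻ˡ r) (∧-true⁻ʳ {P x y} r)

  isUpset-cong : {V W : Sub n} → (∀ y → V y ≡ W y) → isUpset P V ≡ isUpset P W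
  isUpset-cong h = ∀ᶠ-cong λ x → ∀ᶠ-cong λ y → ∧⇒ᵇ-cong refl (h x) (h y)

  isDownset-cong : {V W : Sub n} → (∀ y → V y ≡ W y) → isDownset P V ≡ isDownset P W
  isDownset-cong h = ∀ᶠ-cong λ x → ∀ᶠ-cong λ y → ∧⇒ᵇ-cong refl (h y) (h x)

  isUpset-complement : ∀ D → isUpset P (complement D) ≡ isDownset P D
  isUpset-complement D = ∀ᶠ-cong λ x → ∀ᶠ-cong λ y → ∧⇒ᵇ-contraposition (P x y) (D x) (D y)

  isDownset-complement : ∀ U → isDownset P (complement U) ≡ isUpset P U
  isDownset-complement U = ∀ᶠ-cong λ x → ∀ᶠ-cong λ y → ∧⇒ᵇ-contraposition (P x y) (U y) (U x)

  full-isUpset : isUpset P (λ _ → true) ≡ true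
  full-isUpset = isUpset⁺ (λ _ _ → refl)

-- Extensions as tuples of upsets

module UpsetCovers (m : ℕ) {n : ℕ} (P : Rel n) where
  allUpsets : (Fin m → Sub n) → Bool
  allUpsets T = allᶠ m (λ a → isUpset P (T a))

  ⋃ : (Fin m → Sub n) → Sub n
  ⋃ T y = anyᶠ m (λ a → T a y)

  isUpsetCover : Sub n → (Fin m → Sub n) → Bool
  isUpsetCover U T = allUpsets T ∧ (⋃ T ≈ˢ U)

  #upsetCovers : Sub n → ℕ
  #upsetCovers U = ∑ (allFuns m (allSubs n)) (λ T → isUpsetCover U T ⊙ 1)

  #upsetCovers-cong : ∀ U V → U ≈ˢ V ≡ true → #upsetCovers U ≡ #upsetCovers V
  #upsetCovers-cong U V U≈V = ∑-cong (allFuns m (allSubs n)) λ T → cong (λ b → (allUpsets T ∧ b) ⊙ 1)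
    (≈ˢ-respʳ (⋃ T) U≈V)

  ⋃-isUpset : ∀ T → allUpsets T ≡ true → isUpset P (⋃ T) ≡ true
  ⋃-isUpset T T-upsets = isUpset⁺ P λ {x} {y} x≤y x∈⋃ →
    let (a , x∈Ta) = anyᶠ-true⁻ {m} {λ a → T a x} x∈⋃ in
    anyᶠ-true⁺ {m} {λ a → T a y} a (isUpset⁻ P (allᶠ-true⁻ {m} T-upsets a) x≤y x∈Ta)

-- The ground set Fin (m + k) consists of the new elements a ↑ˡ k and the old ones m ↑ʳ i;
-- an extension R corresponds to the tuple of upsets a ↦ {ι i ∣ a ≤ᴿ m ↑ʳ i}.
module ExtensionsAsUpsetCovers (m : ℕ) {n k : ℕ} (P : Rel n) (isPO : isPartialOrder P ≡ true)
  (U : Sub n) (U-upset : isUpset P U ≡ true) (ι : Fin k → Fin n) (ι-injective : ∀ {i j} → ι i ≡ ι j → i ≡ j)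
  (ι-into : ∀ i → U (ι i) ≡ true) (ι-onto : ∀ y → U y ≡ true → ∃ λ i → ι i ≡ y) where
  open UpsetCovers m P
  open PartialOrder P isPO using () renaming (po-refl to P-refl; po-antisym to P-antisym; po-trans to P-trans)

  Q : Rel k
  Q i j = P (ι i) (ι j)

  view : (x : Fin (m + k)) → (∃ λ a → x ≡ a ↑ˡ k) ⊎ (∃ λ i → x ≡ m ↑ʳ i)
  view x with splitAt m x in eq
  ... | inj₁ a = inj₁ (a , trans (sym (join-splitAt m k x)) (cong (join m k) eq))
  ... | inj₂ i = inj₂ (i , trans (sym (join-splitAt m k x)) (cong (join m k) eq))

  ↑ˡ≢↑ʳ : ∀ {a i} → a ↑ˡ k ≢ m ↑ʳ i
  ↑ˡ≢↑ʳ {a} {i} eq with trans (sym (splitAt-↑ˡ m a k)) (trans (cong (splitAt m) eq) (splitAt-↑ʳ m k i))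
  ... | ()

  inM-↑ˡ : ∀ a → inM {m} {k} (a ↑ˡ k) ≡ true
  inM-↑ˡ a rewrite splitAt-↑ˡ m a k = refl

  inM-↑ʳ : ∀ i → inM {m} {k} (m ↑ʳ i) ≡ false
  inM-↑ʳ i rewrite splitAt-↑ʳ m k i = refl

  upsetsAbove : Rel (m + k) → Fin m → Sub n
  upsetsAbove R a y = anyᶠ k (λ i → ⌊ ι i ≟ y ⌋ ∧ R (a ↑ˡ k) (m ↑ʳ i))

  extension′ : (Fin m → Sub n) → Fin m ⊎ Fin k → Fin m ⊎ Fin k → Bool
  extension′ T (inj₁ a) (inj₁ b) = ⌊ a ≟ b ⌋
  extension′ T (inj₁ a) (inj₂ j) = T a (ι j)
  extension′ T (inj₂ i) (inj₁ b) = false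
  extension′ T (inj₂ i) (inj₂ j) = P (ι i) (ι j)

  extension : (Fin m → Sub n) → Rel (m + k)
  extension T x z = extension′ T (splitAt m x) (splitAt m z)

  extension-cong : ∀ {T T′} → (∀ a y → T a y ≡ T′ a y) → ∀ x z → extension T x z ≡ extension T′ x z
  extension-cong {T} {T′} h x z = go (splitAt m x) (splitAt m z)
    where
    go : ∀ s t → extension′ T s t ≡ extension′ T′ s t
    go (inj₁ a) (inj₁ b) = refl
    go (inj₁ a) (inj₂ j) = h a (ι j)
    go (inj₂ i) (inj₁ b) = refl
    go (inj₂ i) (inj₂ j) = refl

  module _ (T : Fin m → Sub n) where
    extension-ll : ∀ a b → extension T (a ↑ˡ k) (b ↑ˡ k) ≡ ⌊ a ≟ b ⌋
    extension-ll a b rewrite splitAt-↑ˡ m a k | splitAt-↑ˡ m b k = refl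

    extension-lr : ∀ a j → extension T (a ↑ˡ k) (m ↑ʳ j) ≡ T a (ι j)
    extension-lr a j rewrite splitAt-↑ˡ m a k | splitAt-↑ʳ m k j = refl

    extension-rl : ∀ i b → extension T (m ↑ʳ i) (b ↑ˡ k) ≡ false
    extension-rl i b rewrite splitAt-↑ʳ m k i | splitAt-↑ˡ m b k = refl

    extension-rr : ∀ i j → extension T (m ↑ʳ i) (m ↑ʳ j) ≡ P (ι i) (ι j)
    extension-rr i j rewrite splitAt-↑ʳ m k i | splitAt-↑ʳ m k j = refl

    extension-rl-false : ∀ {i b} → extension T (m ↑ʳ i) (b ↑ˡ k) ≡ true → ⊥
    extension-rl-false {i} {b} r = true≢false (trans (sym r) (extension-rl i b))

  isExtension-cong : {R R′ : Rel (m + k)} → (∀ x z → R x z ≡ R′ x z) → isExtension m Q R ≡ isExtension m Q R′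
  isExtension-cong h = cong₂ _∧_
    (cong₂ _∧_ (∀ᶠ-cong λ x → h x x)
      (cong₂ _∧_ (∀ᶠ-cong λ x → ∀ᶠ-cong λ y → ∧⇒ᵇ-cong (h x y) (h y x) refl)
                 (∀ᶠ-cong λ x → ∀ᶠ-cong λ y → ∀ᶠ-cong λ z → ∧⇒ᵇ-cong (h x y) (h y z) (h x z))))
    (cong₂ _∧_ (∀ᶠ-cong λ i → ∀ᶠ-cong λ j → cong (_⇔ᵇ Q i j) (h _ _))
      (∀ᶠ-cong λ x → cong (_⇔ᵇ inM {m} {k} x) (∀ᶠ-cong λ y → cong (_⇒ᵇ ⌊ y ≟ x ⌋) (h y x))))

  module OfCover (T : Fin m → Sub n) (T-cover : isUpsetCover U T ≡ true) where
    T-upset : ∀ a {x y} → P x y ≡ true → T a x ≡ true → T a y ≡ true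
    T-upset a = isUpset⁻ P (allᶠ-true⁻ {m} (∧-true⁻ˡ T-cover) a)

    ⋃T≡U : ∀ y → ⋃ T y ≡ U y
    ⋃T≡U = ≈ˢ-sound (∧-true⁻ʳ {allUpsets T} T-cover)

    E : Rel (m + k)
    E = extension T

    E-refl : ∀ x → E x x ≡ true
    E-refl x with view x
    ... | inj₁ (a , refl) = trans (extension-ll T a a) (≟-complete refl)
    ... | inj₂ (i , refl) = trans (extension-rr T i i) (P-refl (ι i))

    E-antisym : ∀ x y → E x y ≡ true → E y x ≡ true → x ≡ y
    E-antisym x y r s with view x | view y
    ... | inj₁ (a , refl) | inj₁ (b , refl) = cong (_↑ˡ k) (≟-sound (trans (sym (extension-ll T a b)) r))
    ... | inj₁ (a , refl) | inj₂ (j , refl) = ⊥-elim (extension-rl-false T s)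
    ... | inj₂ (i , refl) | inj₁ (b , refl) = ⊥-elim (extension-rl-false T r)
    ... | inj₂ (i , refl) | inj₂ (j , refl) =
      cong (m ↑ʳ_) (ι-injective (P-antisym (trans (sym (extension-rr T i j)) r) (trans (sym (extension-rr T j i)) s)))

    E-trans : ∀ x y z → E x y ≡ true → E y z ≡ true → E x z ≡ true
    E-trans x y z r s with view x | view y | view z
    ... | inj₁ (a , refl) | inj₁ (b , refl) | inj₁ (c , refl) =
      trans (extension-ll T a c)
            (≟-complete (trans (≟-sound (trans (sym (extension-ll T a b)) r)) (≟-sound (trans (sym (extension-ll T b c)) s))))
    ... | inj₁ (a , refl) | inj₁ (b , refl) | inj₂ (j , refl) =
      trans (extension-lr T a j)
            (subst (λ c → T c (ι j) ≡ true) (sym (≟-sound (trans (sym (extension-ll T a b)) r))) (trans (sym (extension-lr T b j)) s))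
    ... | inj₁ (a , refl) | inj₂ (i , refl) | inj₁ (c , refl) = ⊥-elim (extension-rl-false T s)
    ... | inj₁ (a , refl) | inj₂ (i , refl) | inj₂ (j , refl) =
      trans (extension-lr T a j) (T-upset a (trans (sym (extension-rr T i j)) s) (trans (sym (extension-lr T a i)) r))
    ... | inj₂ (i , refl) | inj₁ (b , refl) | _ = ⊥-elim (extension-rl-false T r)
    ... | inj₂ (i , refl) | inj₂ (j , refl) | inj₁ (c , refl) = ⊥-elim (extension-rl-false T s)
    ... | inj₂ (i , refl) | inj₂ (j , refl) | inj₂ (l , refl) =
      trans (extension-rr T i l) (P-trans (trans (sym (extension-rr T i j)) r) (trans (sym (extension-rr T j l)) s))

    -- An old element ι i is not minimal because it lies in ⋃ T = U, i.e. above some new element.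
    E-minimal : ∀ x → isMinimal E x ≡ inM {m} {k} x
    E-minimal x with view x
    ... | inj₁ (a , refl) = trans (∀ᶠ-true⁺ λ y → ⇒ᵇ-true⁺ λ r → ≟-complete (only-below y r)) (sym (inM-↑ˡ a))
      where
      only-below : ∀ y → E y (a ↑ˡ k) ≡ true → y ≡ a ↑ˡ k
      only-below y r with view y
      ... | inj₁ (b , refl) = cong (_↑ˡ k) (≟-sound (trans (sym (extension-ll T b a)) r))
      ... | inj₂ (j , refl) = ⊥-elim (extension-rl-false T r)
    ... | inj₂ (i , refl) = trans (≢true⇒≡false not-minimal) (sym (inM-↑ʳ i))
      where
      not-minimal : isMinimal E (m ↑ʳ i) ≢ true
      not-minimal minimal =
        let (a , ιi∈Ta) = anyᶠ-true⁻ (trans (⋃T≡U (ι i)) (ι-into i)) in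
        ↑ˡ≢↑ʳ (≟-sound (⇒ᵇ-true⁻ (∀ᶠ-true⁻ minimal (a ↑ˡ k)) (trans (extension-lr T a i) ιi∈Ta)))

    extension-isExtension : isExtension m Q E ≡ true
    extension-isExtension = ∧-true⁺
      (∧-true⁺ (∀ᶠ-true⁺ E-refl)
        (∧-true⁺ (∀ᶠ-true⁺ λ x → ∀ᶠ-true⁺ λ y → ⇒ᵇ-true⁺ λ h →
                    ≟-complete (E-antisym x y (∧-true⁻ˡ h) (∧-true⁻ʳ {E x y} h)))
                 (∀ᶠ-true⁺ λ x → ∀ᶠ-true⁺ λ y → ∀ᶠ-true⁺ λ z → ⇒ᵇ-true⁺ λ h →
                    E-trans x y z (∧-true⁻ˡ h) (∧-true⁻ʳ {E x y} h))))
      (∧-true⁺ (∀ᶠ-true⁺ λ i → ∀ᶠ-true⁺ λ j → ⇔ᵇ-true⁺ (extension-rr T i j))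
               (∀ᶠ-true⁺ λ x → ⇔ᵇ-true⁺ (E-minimal x)))

    upsetsAbove-extension : ∀ a y → upsetsAbove E a y ≡ T a y
    upsetsAbove-extension a y = ≡-from-⇔-true to from
      where
      to : upsetsAbove E a y ≡ true → T a y ≡ true
      to h = let (i , r) = anyᶠ-true⁻ h in
        subst (λ z → T a z ≡ true) (≟-sound (∧-true⁻ˡ r)) (trans (sym (extension-lr T a i)) (∧-true⁻ʳ {⌊ ι i ≟ y ⌋} r))
      from : T a y ≡ true → upsetsAbove E a y ≡ true
      from y∈Ta = let (i , ιi≡y) = ι-onto y (trans (sym (⋃T≡U y)) (anyᶠ-true⁺ a y∈Ta)) in
        anyᶠ-true⁺ i (∧-true⁺ (≟-complete ιi≡y) (trans (extension-lr T a i) (subst (λ z → T a z ≡ true) (sym ιi≡y) y∈Ta)))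

  module OfExtension (R : Rel (m + k)) (R-extension : isExtension m Q R ≡ true) where
    open PartialOrder R (∧-true⁻ˡ R-extension)

    R-induces-Q : ∀ i j → R (m ↑ʳ i) (m ↑ʳ j) ≡ Q i j
    R-induces-Q i j = ⇔ᵇ-true⁻ (∀ᶠ-true⁻ (∀ᶠ-true⁻ (∧-true⁻ˡ (∧-true⁻ʳ {isPartialOrder R} R-extension)) i) j)

    R-minimal : ∀ x → isMinimal R x ≡ inM {m} {k} x
    R-minimal x = ⇔ᵇ-true⁻ (∀ᶠ-true⁻ (∧-true⁻ʳ {∀ᶠ k (λ i → ∀ᶠ k (λ j → R (m ↑ʳ i) (m ↑ʳ j) ⇔ᵇ Q i j))}
                                                (∧-true⁻ʳ {isPartialOrder R} R-extension)) x)

    ↑ˡ-minimal : ∀ b → isMinimal R (b ↑ˡ k) ≡ true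
    ↑ˡ-minimal b = trans (R-minimal _) (inM-↑ˡ b)

    upsetsAbove-allUpsets : allUpsets (upsetsAbove R) ≡ true
    upsetsAbove-allUpsets = allᶠ-true⁺ {m} λ a → isUpset⁺ P λ {y} {z} y≤z y-above →
      let (i , r) = anyᶠ-true⁻ y-above
          ιi≡y = ≟-sound (∧-true⁻ˡ r)
          (j , ιj≡z) = ι-onto z (isUpset⁻ P U-upset y≤z (subst (λ w → U w ≡ true) ιi≡y (ι-into i)))
          ιi≤ιj : P (ι i) (ι j) ≡ true
          ιi≤ιj = subst₂ (λ u v → P u v ≡ true) (sym ιi≡y) (sym ιj≡z) y≤z
      in anyᶠ-true⁺ j (∧-true⁺ (≟-complete ιj≡z) (po-trans (∧-true⁻ʳ {⌊ ι i ≟ y ⌋} r) (trans (R-induces-Q i j) ιi≤ιj)))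

    -- Every old element lies above a minimal element, which must be a new one.
    ⋃-upsetsAbove : ∀ y → ⋃ (upsetsAbove R) y ≡ U y
    ⋃-upsetsAbove y = ≡-from-⇔-true to from
      where
      to : ⋃ (upsetsAbove R) y ≡ true → U y ≡ true
      to h = let (a , y-above-a) = anyᶠ-true⁻ {m} {λ a → upsetsAbove R a y} h
                 (i , r) = anyᶠ-true⁻ {k} {λ i → ⌊ ι i ≟ y ⌋ ∧ R (a ↑ˡ k) (m ↑ʳ i)} y-above-a
             in subst (λ w → U w ≡ true) (≟-sound (∧-true⁻ˡ r)) (ι-into i)
      from : U y ≡ true → ⋃ (upsetsAbove R) y ≡ true
      from y∈U with ι-onto y y∈U
      ... | i , ιi≡y with minimal-below (m ↑ʳ i)
      ... | z , z-minimal , z≤i with view z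
      ... | inj₁ (a , refl) = anyᶠ-true⁺ {m} {λ a → upsetsAbove R a y} a
                                (anyᶠ-true⁺ {k} {λ i → ⌊ ι i ≟ y ⌋ ∧ R (a ↑ˡ k) (m ↑ʳ i)} i (∧-true⁺ (≟-complete ιi≡y) z≤i))
      ... | inj₂ (j , refl) = ⊥-elim (true≢false (trans (sym z-minimal) (trans (R-minimal _) (inM-↑ʳ j))))

    extension-upsetsAbove : ∀ x z → extension (upsetsAbove R) x z ≡ R x z
    extension-upsetsAbove x z with view x | view z
    ... | inj₁ (a , refl) | inj₁ (b , refl) = trans (extension-ll (upsetsAbove R) a b)
          (≡-from-⇔-true (λ h → subst (λ c → R (a ↑ˡ k) (c ↑ˡ k) ≡ true) (≟-sound h) (po-refl _))
                         (λ r → ≟-complete (↑ˡ-injective k a b (≟-sound (⇒ᵇ-true⁻ (∀ᶠ-true⁻ (↑ˡ-minimal b) (a ↑ˡ k)) r)))))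
    ... | inj₁ (a , refl) | inj₂ (j , refl) = trans (extension-lr (upsetsAbove R) a j)
          (≡-from-⇔-true (λ h → let (i , r) = anyᶠ-true⁻ h in
                                subst (λ c → R (a ↑ˡ k) (m ↑ʳ c) ≡ true) (ι-injective (≟-sound (∧-true⁻ˡ r))) (∧-true⁻ʳ {⌊ ι i ≟ ι j ⌋} r))
                         (λ r → anyᶠ-true⁺ j (∧-true⁺ (≟-complete refl) r)))
    ... | inj₂ (i , refl) | inj₁ (b , refl) = trans (extension-rl (upsetsAbove R) i b)
          (sym (≢true⇒≡false λ r → ↑ˡ≢↑ʳ (sym (≟-sound (⇒ᵇ-true⁻ (∀ᶠ-true⁻ (↑ˡ-minimal b) (m ↑ʳ i)) r)))))
    ... | inj₂ (i , refl) | inj₂ (j , refl) = trans (extension-rr (upsetsAbove R) i j) (sym (R-induces-Q i j))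

  relationEnumeration : Enumeration (Rel (m + k))
  relationEnumeration = functionEnumeration (m + k) (subsetEnumeration (m + k))

  tupleEnumeration : Enumeration (Fin m → Sub n)
  tupleEnumeration = functionEnumeration m (subsetEnumeration n)
  open Enumeration relationEnumeration using () renaming (_≈ᵇ_ to _≈ᴿ_)
  open Enumeration tupleEnumeration using () renaming (_≈ᵇ_ to _≈ᵀ_)

  ≈ᴿ-sound : ∀ {R R′} → R ≈ᴿ R′ ≡ true → ∀ x z → R x z ≡ R′ x z
  ≈ᴿ-sound h x = ≈ˢ-sound (allᶠ-true⁻ {m + k} h x)

  ≈ᴿ-complete : ∀ {R R′ : Rel (m + k)} → (∀ x z → R x z ≡ R′ x z) → R ≈ᴿ R′ ≡ true
  ≈ᴿ-complete h = allᶠ-true⁺ {m + k} λ x → ≈ˢ-complete (h x)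

  ≈ᵀ-sound : ∀ {T T′} → T ≈ᵀ T′ ≡ true → ∀ a y → T a y ≡ T′ a y
  ≈ᵀ-sound h a = ≈ˢ-sound (allᶠ-true⁻ {m} h a)

  ≈ᵀ-complete : ∀ {T T′ : Fin m → Sub n} → (∀ a y → T a y ≡ T′ a y) → T ≈ᵀ T′ ≡ true
  ≈ᵀ-complete h = allᶠ-true⁺ {m} λ a → ≈ˢ-complete (h a)

  forth : ∀ R T → isExtension m Q R ≡ true → upsetsAbove R ≈ᵀ T ≡ true →
    (isUpsetCover U T ≡ true × extension T ≈ᴿ R ≡ true) × 1 ≡ 1
  forth R T R-extension R≈T = (∧-true⁺ T-upsets ⋃T≈U , ≈ᴿ-complete extension≡R) , refl
    where
    open OfExtension R R-extension
    same : ∀ a y → upsetsAbove R a y ≡ T a y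
    same = ≈ᵀ-sound R≈T
    T-upsets : allUpsets T ≡ true
    T-upsets = allᶠ-true⁺ {m} λ a → trans (sym (isUpset-cong P (same a))) (allᶠ-true⁻ {m} upsetsAbove-allUpsets a)
    ⋃T≈U : ⋃ T ≈ˢ U ≡ true
    ⋃T≈U = ≈ˢ-complete λ y → trans (anyᶠ-cong λ a → sym (same a y)) (⋃-upsetsAbove y)
    extension≡R : ∀ x z → extension T x z ≡ R x z
    extension≡R x z = trans (extension-cong (λ a y → sym (same a y)) x z) (extension-upsetsAbove x z)

  back : ∀ R T → isUpsetCover U T ≡ true → extension T ≈ᴿ R ≡ true →
    isExtension m Q R ≡ true × upsetsAbove R ≈ᵀ T ≡ true
  back R T T-cover T≈R =
    trans (sym (isExtension-cong same)) extension-isExtension ,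
    ≈ᵀ-complete λ a y → trans (anyᶠ-cong λ i → cong (⌊ ι i ≟ y ⌋ ∧_) (sym (same _ _))) (upsetsAbove-extension a y)
    where
    open OfCover T T-cover
    same : ∀ x z → extension T x z ≡ R x z
    same = ≈ᴿ-sound T≈R

  e≡#upsetCovers : e m Q ≡ #upsetCovers U
  e≡#upsetCovers = trans (length-filterᵇ (isExtension m Q) (allRels (m + k)))
    (∑-reindex relationEnumeration tupleEnumeration (isExtension m Q) (isUpsetCover U) (λ _ → 1) (λ _ → 1)
               upsetsAbove extension forth back)

lookup-injective : {A : Set} {xs : List A} → Unique xs → ∀ i j → lookup xs i ≡ lookup xs j → i ≡ j
lookup-injective (_ ∷ _) zero zero _ = refl
lookup-injective (x∉xs ∷ _) zero (suc j) eq = ⊥-elim (All.lookup x∉xs (∈-lookup j) eq)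
lookup-injective (x∉xs ∷ _) (suc i) zero eq = ⊥-elim (All.lookup x∉xs (∈-lookup i) (sym eq))
lookup-injective (_ ∷ xs-unique) (suc i) (suc j) eq = cong suc (lookup-injective xs-unique i j eq)

module _ {n : ℕ} (U : Sub n) where
  elems-lookup-∈ : ∀ i → U (lookup (elems U) i) ≡ true
  elems-lookup-∈ i = Equivalence.to T-≡ (proj₂ (∈-filter⁻ (T? ∘ U) {xs = allFin n} (∈-lookup i)))

  elems-lookup-onto : ∀ y → U y ≡ true → ∃ λ i → lookup (elems U) i ≡ y
  elems-lookup-onto y y∈U =
    let y∈elems = ∈-filter⁺ (T? ∘ U) (∈-allFin y) (Equivalence.from T-≡ y∈U) in
    index y∈elems , sym (lookup-index y∈elems)

  elems-lookup-injective : ∀ {i j} → lookup (elems U) i ≡ lookup (elems U) j → i ≡ j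
  elems-lookup-injective = lookup-injective (filter⁺ (T? ∘ U) (allFin⁺ n)) _ _

isFull≡full≈ˢ : {n : ℕ} (U : Sub n) → isFull U ≡ ((λ _ → true) ≈ˢ U)
isFull≡full≈ˢ U = ≡-from-⇔-true (λ h → ≈ˢ-complete λ y → sym (∀ᶠ-true⁻ {p = U} h y))
                                (λ h → ∀ᶠ-true⁺ λ y → sym (≈ˢ-sound h y))

module Counting {n : ℕ} (P : Rel n) (isPO : isPartialOrder P ≡ true) (m : ℕ) where
  open UpsetCovers m P

  subsets : List (Sub n)
  subsets = allSubs n

  full : Sub n
  full _ = true

  ∑-downsets-complement : (w : Sub n → ℕ) → (∀ U V → U ≈ˢ V ≡ true → w U ≡ w V) →
    ∑ subsets (λ D → isDownset P D ⊙ w (complement D)) ≡ ∑ subsets (λ U → isUpset P U ⊙ w U)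
  ∑-downsets-complement w w-cong = ∑-reindex (subsetEnumeration n) (subsetEnumeration n)
    (isDownset P) (isUpset P) (w ∘ complement) w complement complement forth back
    where
    complement-complement : ∀ {D U} → complement D ≈ˢ U ≡ true → complement U ≈ˢ D ≡ true
    complement-complement {D} D′≈U = ≈ˢ-complete λ y →
      trans (cong not (sym (≈ˢ-sound D′≈U y))) (not-involutive (D y))
    forth : ∀ D U → isDownset P D ≡ true → complement D ≈ˢ U ≡ true →
      (isUpset P U ≡ true × complement U ≈ˢ D ≡ true) × w U ≡ w (complement D)
    forth D U D-downset D′≈U =
      (trans (isUpset-cong P (λ y → sym (≈ˢ-sound D′≈U y))) (trans (isUpset-complement P D) D-downset) ,
       complement-complement D′≈U) ,
      sym (w-cong _ _ D′≈U)
    back : ∀ D U → isUpset P U ≡ true → complement U ≈ˢ D ≡ true →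
      isDownset P D ≡ true × complement D ≈ˢ U ≡ true
    back D U U-upset U′≈D =
      trans (isDownset-cong P (λ y → sym (≈ˢ-sound U′≈D y))) (trans (isDownset-complement P U) U-upset) ,
      complement-complement U′≈D

  d≡#upsets : d P ≡ ∑ subsets (λ U → isUpset P U ⊙ 1)
  d≡#upsets = trans (length-filterᵇ (isDownset P) subsets) (∑-downsets-complement (λ _ → 1) (λ _ _ _ → refl))

  -- Summing over the union U of an m-tuple of upsets counts every such tuple once.
  ∑-#upsetCovers : ∑ subsets (λ U → isUpset P U ⊙ #upsetCovers U) ≡ ∑ subsets (λ U → isUpset P U ⊙ 1) ^ m
  ∑-#upsetCovers = begin
      ∑ subsets (λ U → isUpset P U ⊙ #upsetCovers U)
    ≡⟨ ∑-cong subsets (λ U → sym (∑-⊙ tuples (isUpset P U) _)) ⟩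
      ∑ subsets (λ U → ∑ tuples (λ T → isUpset P U ⊙ (allUpsets T ∧ (⋃ T ≈ˢ U)) ⊙ 1))
    ≡⟨ ∑-swap subsets tuples _ ⟩
      ∑ tuples (λ T → ∑ subsets (λ U → isUpset P U ⊙ (allUpsets T ∧ (⋃ T ≈ˢ U)) ⊙ 1))
    ≡⟨ ∑-cong tuples (λ T → trans (∑-cong subsets (λ U → reorder (isUpset P U) (allUpsets T) (⋃ T ≈ˢ U)))
                                  (∑-⊙ subsets (allUpsets T) _)) ⟩
      ∑ tuples (λ T → allUpsets T ⊙ ∑ subsets (λ U → (⋃ T ≈ˢ U) ⊙ isUpset P U ⊙ 1))
    ≡⟨ ∑-cong tuples (λ T → cong (allUpsets T ⊙_) (∑-collapse (subsetEnumeration n) (⋃ T) (λ U → isUpset P U ⊙ 1)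
          (λ V ⋃T≈V → cong (_⊙ 1) (isUpset-cong P (λ y → sym (≈ˢ-sound ⋃T≈V y)))))) ⟩
      ∑ tuples (λ T → allUpsets T ⊙ isUpset P (⋃ T) ⊙ 1)
    ≡⟨ ∑-cong tuples (λ T → ⊙-cong-true (allUpsets T) (λ T-upsets → cong (_⊙ 1) (⋃-isUpset T T-upsets))) ⟩
      ∑ tuples (λ T → allUpsets T ⊙ 1)
    ≡⟨ count-allFuns m subsets (isUpset P) ⟩
      ∑ subsets (λ U → isUpset P U ⊙ 1) ^ m ∎
    where
    open ≡-Reasoning
    tuples : List (Fin m → Sub n)
    tuples = allFuns m (allSubs n)
    reorder : (a b c : Bool) → a ⊙ (b ∧ c) ⊙ 1 ≡ b ⊙ c ⊙ a ⊙ 1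
    reorder true true true = refl
    reorder true true false = refl
    reorder true false c = refl
    reorder false true true = refl
    reorder false true false = refl
    reorder false false c = refl

  ∑-#upsetCovers≡d^m : ∑ subsets (λ U → isUpset P U ⊙ #upsetCovers U) ≡ d P ^ m
  ∑-#upsetCovers≡d^m = trans ∑-#upsetCovers (cong (_^ m) (sym d≡#upsets))

  eSub≡#upsetCovers : ∀ U → isUpset P U ≡ true → eSub m P U ≡ #upsetCovers U
  eSub≡#upsetCovers U U-upset = ExtensionsAsUpsetCovers.e≡#upsetCovers m P isPO U U-upset
    (lookup (elems U)) (elems-lookup-injective U) (elems-lookup-∈ U) (elems-lookup-onto U)

  e≡#upsetCovers-full : e m P ≡ #upsetCovers full
  e≡#upsetCovers-full = ExtensionsAsUpsetCovers.e≡#upsetCovers m P isPO full (full-isUpset P)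
    id id (λ _ → refl) (λ y _ → y , refl)

  ∑-upsets-eSub : ∑ subsets (λ U → isUpset P U ⊙ eSub m P U) ≡ ∑ subsets (λ U → isUpset P U ⊙ #upsetCovers U)
  ∑-upsets-eSub = ∑-cong subsets λ U → ⊙-cong-true (isUpset P U) (eSub≡#upsetCovers U)

  d^m≡∑-upsets : d P ^ m ≡ sum (map (λ U → eSub m P U) (upsets P))
  d^m≡∑-upsets = sym (begin
      sum (map (eSub m P) (upsets P))
    ≡⟨ sum-map (upsets P) (eSub m P) ⟩
      ∑ (upsets P) (eSub m P)
    ≡⟨ ∑-filterᵇ (isUpset P) (eSub m P) subsets ⟩
      ∑ subsets (λ U → isUpset P U ⊙ eSub m P U)
    ≡⟨ ∑-upsets-eSub ⟩
      ∑ subsets (λ U → isUpset P U ⊙ #upsetCovers U)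
    ≡⟨ ∑-#upsetCovers≡d^m ⟩
      d P ^ m ∎)
    where open ≡-Reasoning

  d^m≡∑-downsets : d P ^ m ≡ sum (map (λ D → eSub m P (complement D)) (downsets P))
  d^m≡∑-downsets = sym (begin
      sum (map (eSub m P ∘ complement) (downsets P))
    ≡⟨ sum-map (downsets P) (eSub m P ∘ complement) ⟩
      ∑ (downsets P) (eSub m P ∘ complement)
    ≡⟨ ∑-filterᵇ (isDownset P) (eSub m P ∘ complement) subsets ⟩
      ∑ subsets (λ D → isDownset P D ⊙ eSub m P (complement D))
    ≡⟨ ∑-cong subsets (λ D → ⊙-cong-true (isDownset P D) λ D-downset →
          eSub≡#upsetCovers (complement D) (trans (isUpset-complement P D) D-downset)) ⟩
      ∑ subsets (λ D → isDownset P D ⊙ #upsetCovers (complement D))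
    ≡⟨ ∑-downsets-complement #upsetCovers #upsetCovers-cong ⟩
      ∑ subsets (λ U → isUpset P U ⊙ #upsetCovers U)
    ≡⟨ ∑-#upsetCovers≡d^m ⟩
      d P ^ m ∎)
    where open ≡-Reasoning

  split-full : ∀ U → isUpset P U ⊙ #upsetCovers U
                   ≡ isUpset P U ⊙ not (isFull U) ⊙ #upsetCovers U + (full ≈ˢ U) ⊙ #upsetCovers U
  split-full U with full ≈ˢ U in full≈U
  ... | true rewrite isFull≡full≈ˢ U | full≈U
                   | trans (isUpset-cong P (λ y → sym (≈ˢ-sound full≈U y))) (full-isUpset P) = refl
  ... | false rewrite isFull≡full≈ˢ U | full≈U = sym (+-identityʳ _)

  r≡∑-proper-upsets : r m P ≡ sum (map (λ U → eSub m P U) (filterᵇ (λ U → not (isFull U)) (upsets P)))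
  r≡∑-proper-upsets = begin
      d P ^ m ∸ e m P
    ≡⟨ cong₂ _∸_ (sym ∑-#upsetCovers≡d^m) e≡#upsetCovers-full ⟩
      ∑ subsets (λ U → isUpset P U ⊙ #upsetCovers U) ∸ #upsetCovers full
    ≡⟨ cong (_∸ #upsetCovers full) (trans (∑-cong subsets split-full) (∑-+ subsets _ _)) ⟩
      proper + ∑ subsets (λ U → (full ≈ˢ U) ⊙ #upsetCovers U) ∸ #upsetCovers full
    ≡⟨ cong (λ x → proper + x ∸ #upsetCovers full)
            (∑-collapse (subsetEnumeration n) full #upsetCovers (λ V h → sym (#upsetCovers-cong full V h))) ⟩
      proper + #upsetCovers full ∸ #upsetCovers full
    ≡⟨ m+n∸n≡m proper (#upsetCovers full) ⟩
      proper
    ≡⟨ ∑-cong subsets (λ U → ⊙-cong-true (isUpset P U) λ U-upset →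
          cong (not (isFull U) ⊙_) (sym (eSub≡#upsetCovers U U-upset))) ⟩
      ∑ subsets (λ U → isUpset P U ⊙ not (isFull U) ⊙ eSub m P U)
    ≡⟨ sym (∑-filterᵇ (isUpset P) _ subsets) ⟩
      ∑ (upsets P) (λ U → not (isFull U) ⊙ eSub m P U)
    ≡⟨ sym (∑-filterᵇ (not ∘ isFull) (eSub m P) (upsets P)) ⟩
      ∑ (filterᵇ (not ∘ isFull) (upsets P)) (eSub m P)
    ≡⟨ sym (sum-map (filterᵇ (not ∘ isFull) (upsets P)) (eSub m P)) ⟩
      sum (map (eSub m P) (filterᵇ (not ∘ isFull) (upsets P))) ∎
    where
    open ≡-Reasoning
    proper : ℕ
    proper = ∑ subsets (λ U → isUpset P U ⊙ not (isFull U) ⊙ #upsetCovers U)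

theorem5p1 : (n : ℕ) (P : Rel n) → isPartialOrder P ≡ true → (m : ℕ) → 1 ≤ m →
    (d P ^ m ≡ sum (map (λ D → eSub m P (complement D)) (downsets P)))
    × (d P ^ m ≡ sum (map (λ U → eSub m P U) (upsets P)))
    × (r m P ≡ sum (map (λ U → eSub m P U) (filterᵇ (λ U → not (isFull U)) (upsets P))))
theorem5p1 n P isPO m _ = d^m≡∑-downsets , d^m≡∑-upsets , r≡∑-proper-upsets
  where open Counting P isPO m
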